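{- Let $R\in\mathbb N^p$, $C\in\mathbb N^q$, and let $\mathbf B\in\mathcal M(R,C)$ be a split zebra or a split anti-zebra. Then for every $\mathbf A\in\mathcal M(R,C)$, $\mathbf B$ can be reached from $\mathbf A$ via a (possibly empty) finite sequence of positive switches.
   Context: $\mathcal M(R,C)$ denotes the set of $p\times q$ $(0,1)$-matrices with row sums $R$ and column sums $C$. A checkerboard is a $2\times2$ submatrix on rows $i<j$ and columns $k<l$; it is positive if equal to $\begin{pmatrix}1&0\\0&1\end{pmatrix}$ and negative if equal to $\begin{pmatrix}0&1\\1&0\end{pmatrix}$. A positive switch replaces a negative checkerboard by the positive one on the same rows and columns. A $(0,1)$-matrix is nested (resp. anti-nested) if in every row and column all $1$s precede all $0$s (resp. all $0$s precede all $1$s). A zebra is a matrix of $\mathcal M(R,C)$ which equals $\mathbf N+\mathbf N'$ with $\mathbf N$ nested and $\mathbf N'$ anti-nested $(0,1)$-matrices. A zebra is split vertically (resp. horizontally) if it admits such a decomposition in which no column (resp. no row) contains $1$s of both $\mathbf N$ and $\mathbf N'$; a split zebra is a zebra split vertically or horizontally. A split anti-zebra is a matrix $\mathbf B$ with $b_{ij}=1-a_{p+1-i,j}$ for some split zebra $\mathbf A$ (the complement of the row-reversal of a split zebra). -}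

module Defs where

open import Data.Nat using (ℕ; zero; suc; _+_)
open import Data.Bool using (Bool; true; false; not; if_then_else_)
open import Data.Fin using (Fin; _<_; _≤_; opposite)
import Data.Fin as F
open import Data.Product using (Σ; ∃; _×_; _,_)
open import Data.Sum using (_⊎_)
open import Relation.Binary.PropositionalEquality using (_≡_)
open import Relation.Nullary using (¬_)
open import Relation.Binary.Construct.Closure.ReflexiveTransitive using (Star)

Matrix : ℕ → ℕ → Set
Matrix p q = Fin p → Fin q → Bool

b2n : Bool → ℕ
b2n true  = 1
b2n false = 0

sumFin : (n : ℕ) → (Fin n → ℕ) → ℕ
sumFin zero    f = 0
sumFin (suc n) f = f F.zero + sumFin n (λ i → f (F.suc i))

rowSum : ∀ {p q} → Matrix p q → Fin p → ℕ
rowSum {q = q} A i = sumFin q (λ j → b2n (A i j))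

colSum : ∀ {p q} → Matrix p q → Fin q → ℕ
colSum {p = p} A j = sumFin p (λ i → b2n (A i j))

InM : ∀ {p q} → (Fin p → ℕ) → (Fin q → ℕ) → Matrix p q → Set
InM R C A = (∀ i → rowSum A i ≡ R i) × (∀ j → colSum A j ≡ C j)

PosSwitchAt : ∀ {p q} → Matrix p q → Matrix p q →
              Fin p → Fin p → Fin q → Fin q → Set
PosSwitchAt A A' i j k l =
  (i < j) × (k < l) ×
  (A i k ≡ false) × (A i l ≡ true) × (A j k ≡ true) × (A j l ≡ false) ×
  (A' i k ≡ true) × (A' i l ≡ false) × (A' j k ≡ false) × (A' j l ≡ true) ×
  (∀ r c → ¬ ((r ≡ i ⊎ r ≡ j) × (c ≡ k ⊎ c ≡ l)) → A' r c ≡ A r c)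

PosSwitch : ∀ {p q} → Matrix p q → Matrix p q → Set
PosSwitch A A' = ∃ λ i → ∃ λ j → ∃ λ k → ∃ λ l → PosSwitchAt A A' i j k l

-- B reachable from A by a (possibly empty) finite sequence of positive switches
-- (matrices compared entrywise, since functions are not extensional here)
Reachable : ∀ {p q} → Matrix p q → Matrix p q → Set
Reachable A B = ∃ λ B' → Star PosSwitch A B' × (∀ i j → B' i j ≡ B i j)

Nested : ∀ {p q} → Matrix p q → Set
Nested N = (∀ i k l → k ≤ l → N i l ≡ true → N i k ≡ true)
         × (∀ j i i' → i ≤ i' → N i' j ≡ true → N i j ≡ true)

AntiNested : ∀ {p q} → Matrix p q → Set
AntiNested N = (∀ i k l → k ≤ l → N i k ≡ true → N i l ≡ true)
             × (∀ j i i' → i ≤ i' → N i j ≡ true → N i' j ≡ true)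

Decomp : ∀ {p q} → Matrix p q → Matrix p q → Matrix p q → Set
Decomp A N N' = Nested N × AntiNested N' ×
                (∀ i j → b2n (A i j) ≡ b2n (N i j) + b2n (N' i j))

Zebra : ∀ {p q} → Matrix p q → Set
Zebra A = ∃ λ N → ∃ λ N' → Decomp A N N'

SplitVertically : ∀ {p q} → Matrix p q → Set
SplitVertically A = ∃ λ N → ∃ λ N' → Decomp A N N' ×
  (∀ j → (∀ i → N i j ≡ false) ⊎ (∀ i → N' i j ≡ false))

SplitHorizontally : ∀ {p q} → Matrix p q → Set
SplitHorizontally A = ∃ λ N → ∃ λ N' → Decomp A N N' ×
  (∀ i → (∀ j → N i j ≡ false) ⊎ (∀ j → N' i j ≡ false))

SplitZebra : ∀ {p q} → Matrix p q → Set
SplitZebra A = SplitVertically A ⊎ SplitHorizontally A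

SplitAntiZebra : ∀ {p q} → Matrix p q → Set
SplitAntiZebra {p} {q} B = ∃ λ (A : Matrix p q) → SplitZebra A ×
  (∀ i j → B i j ≡ not (A (opposite i) j))

-- A positive switch strictly increases the potential Σ i·j·a_ij, which is bounded, so
-- switching from A as long as a negative checkerboard exists ends after finitely many
-- steps at a negative-free matrix of 𝓜(R,C); it remains to see that B is the only one.
-- Up to transposition, every column of B is top- or bottom-justified, the top-justified
-- columns coming first; this survives complementing and reversing the rows, which covers
-- anti-zebras. If a negative-free A differed from B, some row r would have a_rc < b_rc;
-- equal column and then row sums give a row r′ with the same defect, and the step r ⇝ r′
-- moves in the direction in which column c of B is justified. Negative-freeness makes ⇝ a
-- strict order on the finitely many rows, so such an endless chain cannot exist.

module Submission where

open import Defs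
open import Data.Bool using (Bool; true; false; not; _xor_)
import Data.Bool.Properties as Bool
open import Data.Empty using (⊥-elim)
open import Data.Fin using (Fin; zero; suc; toℕ; opposite; _≤_; _<_; _≟_)
import Data.Fin.Properties as Fin
open import Data.Fin.Induction using (spo-noetherian)
open import Data.List using (_∷_; [])
import Data.Nat as ℕ
open import Data.Nat using (ℕ; _+_; _*_; _∸_; z≤n; s≤s)
open import Data.Nat.Induction using (<-wellFounded)
open import Data.Nat.Properties hiding (_≟_)
open import Data.Nat.Tactic.RingSolver using (solve)
open import Data.Product using (∃; _×_; _,_; proj₁; proj₂; swap)
open import Data.Sum using (_⊎_; inj₁; inj₂; [_,_])
open import Data.Vec.Functional using (updateAt)
open import Data.Vec.Functional.Properties using (updateAt-updates; updateAt-minimal)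
open import Function using (_∘_; flip)
open import Induction.WellFounded using (Acc; acc)
open import Relation.Binary using (Transitive; IsStrictPartialOrder; tri<; tri≈; tri>)
open import Relation.Binary.Construct.Closure.ReflexiveTransitive using (ε; _◅_)
open import Relation.Binary.PropositionalEquality hiding ([_])
open import Relation.Nullary using (¬_; Dec; yes; no; does; ¬?; _×-dec_; _⊎-dec_; contradiction)
open import Relation.Nullary.Decidable using (dec-true; dec-false; decidable-stable)

open import Algebra.Properties.Semiring.Sum +-*-semiring using (sum; sum-cong-≗)
open import Algebra.Properties.CommutativeSemigroup +-commutativeSemigroup
  using (xy∙z≈zy∙x; xy∙z≈xz∙y; xy∙z≈x∙zy)

private
  variable
    n p q : ℕ
    A A′ : Matrix p q
    i j : Fin p
    k l : Fin q

_≐_ : Matrix p q → Matrix p q → Set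
A ≐ B = ∀ i j → A i j ≡ B i j

transpose : Matrix p q → Matrix q p
transpose M j i = M i j

sumFin≡sum : ∀ n (f : Fin n → ℕ) → sumFin n f ≡ sum f
sumFin≡sum ℕ.zero    f = refl
sumFin≡sum (ℕ.suc n) f = cong (f zero +_) (sumFin≡sum n (f ∘ suc))

sum-mono-≤ : {f g : Fin n → ℕ} → (∀ i → f i ℕ.≤ g i) → sum f ℕ.≤ sum g
sum-mono-≤ {ℕ.zero}  f≤g = z≤n
sum-mono-≤ {ℕ.suc n} f≤g = +-mono-≤ (f≤g zero) (sum-mono-≤ (f≤g ∘ suc))

sum-mono-< : {f g : Fin n → ℕ} → (∀ i → f i ℕ.≤ g i) → ∀ c → f c ℕ.< g c → sum f ℕ.< sum g
sum-mono-< f≤g zero    fc<gc = +-mono-<-≤ fc<gc (sum-mono-≤ (f≤g ∘ suc))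
sum-mono-< f≤g (suc c) fc<gc = +-mono-≤-< (f≤g zero) (sum-mono-< (f≤g ∘ suc) c fc<gc)

sum-update : {u v : Fin n → ℕ} (k : Fin n) → (∀ y → y ≢ k → u y ≡ v y) →
             sum u + v k ≡ sum v + u k
sum-update {u = u} {v} zero others = begin
  u zero + sum (u ∘ suc) + v zero
    ≡⟨ cong (λ s → u zero + s + v zero) (sum-cong-≗ λ y → others (suc y) λ ()) ⟩
  u zero + sum (v ∘ suc) + v zero
    ≡⟨ xy∙z≈zy∙x (u zero) _ _ ⟩
  v zero + sum (v ∘ suc) + u zero ∎
  where open ≡-Reasoning
sum-update {u = u} {v} (suc k) others = begin
  u zero + sum (u ∘ suc) + v (suc k)   ≡⟨ +-assoc (u zero) _ _ ⟩
  u zero + (sum (u ∘ suc) + v (suc k)) ≡⟨ cong₂ _+_ (others zero λ ()) tail-update ⟩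
  v zero + (sum (v ∘ suc) + u (suc k)) ≡⟨ +-assoc (v zero) _ _ ⟨
  v zero + sum (v ∘ suc) + u (suc k)   ∎
  where
  open ≡-Reasoning
  tail-update : sum (u ∘ suc) + v (suc k) ≡ sum (v ∘ suc) + u (suc k)
  tail-update = sum-update k (λ y y≢k → others (suc y) (y≢k ∘ Fin.suc-injective))

sum-update₂ : {u v : Fin n → ℕ} {k l : Fin n} → k ≢ l →
              (∀ y → y ≢ k → y ≢ l → u y ≡ v y) →
              sum u + (v k + v l) ≡ sum v + (u k + u l)
sum-update₂ {u = u} {v} {k} {l} k≢l others = begin
  sum u + (v k + v l) ≡⟨ +-assoc (sum u) _ _ ⟨
  sum u + v k + v l   ≡⟨ cong (λ x → sum u + x + v l) (updateAt-updates k u) ⟨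
  sum u + w k + v l   ≡⟨ cong (_+ v l) (sum-update k u≐w) ⟩
  sum w + u k + v l   ≡⟨ xy∙z≈xz∙y (sum w) _ _ ⟩
  sum w + v l + u k   ≡⟨ cong (_+ u k) (sum-update l w≐v) ⟩
  sum v + w l + u k   ≡⟨ cong (λ x → sum v + x + u k) (updateAt-minimal l k u (k≢l ∘ sym)) ⟩
  sum v + u l + u k   ≡⟨ xy∙z≈x∙zy (sum v) _ _ ⟩
  sum v + (u k + u l) ∎
  where
  open ≡-Reasoning
  w : Fin _ → ℕ
  w = updateAt u k λ _ → v k
  u≐w : ∀ y → y ≢ k → u y ≡ w y
  u≐w y y≢k = sym (updateAt-minimal y k u y≢k)
  w≐v : ∀ y → y ≢ l → w y ≡ v y
  w≐v y y≢l with y ≟ k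
  ... | yes refl = updateAt-updates k u
  ... | no y≢k   = trans (updateAt-minimal y k u y≢k) (others y y≢k y≢l)

rearrangement : ∀ {a b c d} → a ℕ.< b → c ℕ.< d → a * d + b * c ℕ.< a * c + b * d
rearrangement {a} {c = c} a<b c<d with m≤n⇒∃[o]m+o≡n a<b | m≤n⇒∃[o]m+o≡n c<d
... | m , refl | n , refl = begin-strict
  a * (ℕ.suc c + n) + (ℕ.suc a + m) * c
    <⟨ m<m+n _ (s≤s z≤n) ⟩
  a * (ℕ.suc c + n) + (ℕ.suc a + m) * c + ℕ.suc m * ℕ.suc n
    ≡⟨ solve (a ∷ c ∷ m ∷ n ∷ []) ⟩
  a * c + (ℕ.suc a + m) * (ℕ.suc c + n) ∎
  where open ≤-Reasoning

trade-gain : ∀ {i j k l a a′ b b′} → a′ + l ≡ a + k → b′ + k ≡ b + l →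
             i ℕ.< j → k ℕ.< l → i * a + j * b ℕ.< i * a′ + j * b′
trade-gain {i} {j} {k} {l} {a} {a′} {b} {b′} ea eb i<j k<l =
  +-cancelʳ-< (i * l + j * k) _ _ (begin-strict
    i * a + j * b + (i * l + j * k)   <⟨ +-monoʳ-< (i * a + j * b) (rearrangement i<j k<l) ⟩
    i * a + j * b + (i * k + j * l)   ≡⟨ solve (i ∷ j ∷ k ∷ l ∷ a ∷ b ∷ []) ⟩
    i * (a + k) + j * (b + l)         ≡⟨ cong₂ (λ x y → i * x + j * y) ea eb ⟨
    i * (a′ + l) + j * (b′ + k)       ≡⟨ solve (i ∷ j ∷ k ∷ l ∷ a′ ∷ b′ ∷ []) ⟩
    i * a′ + j * b′ + (i * l + j * k) ∎)
  where open ≤-Reasoning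

b2n-injective : ∀ {x y} → b2n x ≡ b2n y → x ≡ y
b2n-injective {false} {false} _ = refl
b2n-injective {true}  {true}  _ = refl

b2n≤1 : ∀ b → b2n b ℕ.≤ 1
b2n≤1 false = z≤n
b2n≤1 true  = s≤s z≤n

weight : (Fin n → ℕ) → (Fin n → Bool) → ℕ
weight w r = sum λ y → b2n (r y) * w y

count : (Fin n → Bool) → ℕ
count = weight λ _ → 1

weight-cong : (w : Fin n → ℕ) {f g : Fin n → Bool} → (∀ y → f y ≡ g y) → weight w f ≡ weight w g
weight-cong w f≐g = sum-cong-≗ λ y → cong (λ b → b2n b * w y) (f≐g y)

weight≤weight-ones : (w : Fin n → ℕ) (f : Fin n → Bool) → weight w f ℕ.≤ weight w (λ _ → true)
weight≤weight-ones w f = sum-mono-≤ λ y → *-monoˡ-≤ (w y) (b2n≤1 (f y))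

weight-exchange : (w : Fin n → ℕ) {f g : Fin n → Bool} {k l : Fin n} → k ≢ l →
                  (∀ y → y ≢ k → y ≢ l → g y ≡ f y) →
                  f k ≡ false → f l ≡ true → g k ≡ true → g l ≡ false →
                  weight w g + w l ≡ weight w f + w k
weight-exchange w {f} {g} {k} {l} k≢l others fk fl gk gl = begin
  weight w g + w l                   ≡⟨ cong (weight w g +_) f-corners ⟨
  weight w g + (cell f k + cell f l) ≡⟨ sum-update₂ k≢l (λ y y≢k y≢l → at g (others y y≢k y≢l)) ⟩
  weight w f + (cell g k + cell g l) ≡⟨ cong (weight w f +_) g-corners ⟩
  weight w f + w k                   ∎
  where
  open ≡-Reasoning
  cell : (Fin _ → Bool) → Fin _ → ℕ
  cell h y = b2n (h y) * w y
  at : ∀ h {y b} → h y ≡ b → cell h y ≡ b2n b * w y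
  at h {y} = cong (λ b → b2n b * w y)
  f-corners : cell f k + cell f l ≡ w l
  f-corners = cong₂ _+_ (at f fk) (trans (at f fl) (*-identityˡ (w l)))
  g-corners : cell g k + cell g l ≡ w k
  g-corners = trans (cong₂ _+_ (trans (at g gk) (*-identityˡ (w k))) (at g gl)) (+-identityʳ (w k))

PosSwitchAt-transpose : PosSwitchAt A A′ i j k l →
                        PosSwitchAt (transpose A) (transpose A′) k l i j
PosSwitchAt-transpose (i<j , k<l , Aik , Ail , Ajk , Ajl , A′ik , A′il , A′jk , A′jl , others) =
  k<l , i<j , Aik , Ajk , Ail , Ajl , A′ik , A′jk , A′il , A′jl ,
  λ r c outside → others c r (outside ∘ swap)

switch-weights : PosSwitchAt A A′ i j k l → (w : Fin q → ℕ) →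
                 (weight w (A′ i) + w l ≡ weight w (A i) + w k) ×
                 (weight w (A′ j) + w k ≡ weight w (A j) + w l) ×
                 (∀ x → x ≢ i → x ≢ j → weight w (A′ x) ≡ weight w (A x))
switch-weights {i = i} {j} (i<j , k<l , Aik , Ail , Ajk , Ajl , A′ik , A′il , A′jk , A′jl , others) w =
    weight-exchange w (Fin.<⇒≢ k<l) (λ y y≢k y≢l → others i y λ (_ , y∈) → [ y≢k , y≢l ] y∈)
                    Aik Ail A′ik A′il
  , weight-exchange w (Fin.<⇒≢ k<l ∘ sym) (λ y y≢l y≢k → others j y λ (_ , y∈) → [ y≢k , y≢l ] y∈)
                    Ajl Ajk A′jl A′jk
  , λ x x≢i x≢j → weight-cong w λ y → others x y λ (x∈ , _) → [ x≢i , x≢j ] x∈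

switch-preserves-count : PosSwitchAt A A′ i j k l → ∀ x → count (A′ x) ≡ count (A x)
switch-preserves-count {i = i} {j} s x with x ≟ i | x ≟ j | switch-weights s (λ _ → 1)
... | yes refl | _        | top , _           = +-cancelʳ-≡ 1 _ _ top
... | no _     | yes refl | _ , bottom , _    = +-cancelʳ-≡ 1 _ _ bottom
... | no x≢i   | no x≢j   | _ , _ , unchanged = unchanged x x≢i x≢j

rowSum≡count : (M : Matrix p q) (x : Fin p) → rowSum M x ≡ count (M x)
rowSum≡count {q = q} M x = trans (sumFin≡sum q _) (sum-cong-≗ λ y → sym (*-identityʳ (b2n (M x y))))

switch-preserves-rowSum : PosSwitchAt A A′ i j k l → ∀ x → rowSum A′ x ≡ rowSum A x
switch-preserves-rowSum {A = A} {A′} s x = begin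
  rowSum A′ x  ≡⟨ rowSum≡count A′ x ⟩
  count (A′ x) ≡⟨ switch-preserves-count s x ⟩
  count (A x)  ≡⟨ rowSum≡count A x ⟨
  rowSum A x   ∎
  where open ≡-Reasoning

switch-preserves-InM : {R : Fin p → ℕ} {C : Fin q → ℕ} →
                       PosSwitchAt A A′ i j k l → InM R C A → InM R C A′
switch-preserves-InM s (rows , cols) =
    (λ x → trans (switch-preserves-rowSum s x) (rows x))
  , (λ y → trans (switch-preserves-rowSum (PosSwitchAt-transpose s) y) (cols y))

potential : Matrix p q → ℕ
potential M = sum λ x → toℕ x * weight toℕ (M x)

ones : Matrix p q
ones _ _ = true

potential≤ones : (M : Matrix p q) → potential M ℕ.≤ potential {p} {q} ones
potential≤ones M = sum-mono-≤ λ x → *-monoʳ-≤ (toℕ x) (weight≤weight-ones toℕ (M x))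

potential-increases : PosSwitchAt A A′ i j k l → potential A ℕ.< potential A′
potential-increases {A = A} {A′} {i} {j} s@(i<j , k<l , _) with switch-weights s toℕ
... | top , bottom , unchanged = +-cancelʳ-< (V i + V j) (sum V) (sum U) (begin-strict
  sum V + (V i + V j) <⟨ +-monoʳ-< (sum V) (trade-gain top bottom i<j k<l) ⟩
  sum V + (U i + U j) ≡⟨ sum-update₂ (Fin.<⇒≢ i<j) other-rows ⟨
  sum U + (V i + V j) ∎)
  where
  open ≤-Reasoning
  U V : Fin _ → ℕ
  U x = toℕ x * weight toℕ (A′ x)
  V x = toℕ x * weight toℕ (A x)
  other-rows : ∀ x → x ≢ i → x ≢ j → U x ≡ V x
  other-rows x x≢i x≢j = cong (toℕ x *_) (unchanged x x≢i x≢j)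

NegativeCheckerboard : Matrix p q → Fin p → Fin p → Fin q → Fin q → Set
NegativeCheckerboard A i j k l =
  i < j × k < l × A i k ≡ false × A i l ≡ true × A j k ≡ true × A j l ≡ false

NegativeFree : Matrix p q → Set
NegativeFree A = ∀ i j k l → ¬ NegativeCheckerboard A i j k l

negativeCheckerboard? : (A : Matrix p q) →
  Dec (∃ λ i → ∃ λ j → ∃ λ k → ∃ λ l → NegativeCheckerboard A i j k l)
negativeCheckerboard? A = Fin.any? λ i → Fin.any? λ j → Fin.any? λ k → Fin.any? λ l →
  i Fin.<? j ×-dec k Fin.<? l ×-dec A i k Bool.≟ false ×-dec A i l Bool.≟ true ×-dec
  A j k Bool.≟ true ×-dec A j l Bool.≟ false

corner? : (i j : Fin p) (k l : Fin q) (x : Fin p) (y : Fin q) →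
          Dec ((x ≡ i ⊎ x ≡ j) × (y ≡ k ⊎ y ≡ l))
corner? i j k l x y = (x ≟ i ⊎-dec x ≟ j) ×-dec (y ≟ k ⊎-dec y ≟ l)

switch : Matrix p q → Fin p → Fin p → Fin q → Fin q → Matrix p q
switch A i j k l x y = does (corner? i j k l x y) xor A x y

switch-positive : NegativeCheckerboard A i j k l → PosSwitchAt A (switch A i j k l) i j k l
switch-positive {A = A} {i} {j} {k} {l} (i<j , k<l , Aik , Ail , Ajk , Ajl) =
  i<j , k<l , Aik , Ail , Ajk , Ajl ,
  flipped (inj₁ refl , inj₁ refl) Aik , flipped (inj₁ refl , inj₂ refl) Ail ,
  flipped (inj₂ refl , inj₁ refl) Ajk , flipped (inj₂ refl , inj₂ refl) Ajl ,
  λ x y outside → cong (_xor A x y) (dec-false (corner? i j k l x y) outside)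
  where
  flipped : ∀ {x y b} → (x ≡ i ⊎ x ≡ j) × (y ≡ k ⊎ y ≡ l) → A x y ≡ b →
            switch A i j k l x y ≡ not b
  flipped {x} {y} corner Axy = trans (cong (_xor A x y) (dec-true (corner? i j k l x y) corner)) (cong not Axy)

-- Reachability of the unique negative-free matrix

module _ {R : Fin p → ℕ} {C : Fin q → ℕ} {B : Matrix p q}
         (negativeFree⇒≐B : ∀ A → InM R C A → NegativeFree A → A ≐ B) where

  reachable-acc : ∀ A → InM R C A → Acc ℕ._<_ (potential {p} {q} ones ∸ potential A) → Reachable A B
  reachable-acc A A∈ (acc smaller) with negativeCheckerboard? A
  ... | no none = A , ε , negativeFree⇒≐B A A∈ λ i j k l nc → none (i , j , k , l , nc)
  ... | yes (i , j , k , l , nc) =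
    let s = switch-positive nc
        B′ , path , B′≐B = reachable-acc (switch A i j k l) (switch-preserves-InM s A∈)
          (smaller (∸-monoʳ-< (potential-increases s) (potential≤ones (switch A i j k l))))
    in B′ , (i , j , k , l , s) ◅ path , B′≐B

  reachable : ∀ A → InM R C A → Reachable A B
  reachable A A∈ = reachable-acc A A∈ (<-wellFounded _)

-- Matrices with justified columns are the only negative-free ones

TopJustified BottomJustified : (Fin n → Bool) → Set
TopJustified    v = ∀ i i′ → i ≤ i′ → v i′ ≡ true → v i ≡ true
BottomJustified v = ∀ i i′ → i ≤ i′ → v i ≡ true → v i′ ≡ true

column : Matrix p q → Fin q → Fin p → Bool
column M c i = M i c

record JustifiedColumns (B : Matrix p q) : Set₁ where
  field
    Top               : Fin q → Set
    top?              : ∀ c → Dec (Top c)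
    top-justified     : ∀ {c} → Top c → TopJustified (column B c)
    bottom-justified  : ∀ {c} → ¬ Top c → BottomJustified (column B c)
    top-before-bottom : ∀ {k l} → Top k → ¬ Top l → k < l

surplus⇒deficit : {f g : Fin n → Bool} → sumFin n (b2n ∘ f) ≡ sumFin n (b2n ∘ g) →
                  ∀ c → f c ≡ true → g c ≡ false → ∃ λ c′ → f c′ ≡ false × g c′ ≡ true
surplus⇒deficit {n} {f} {g} same c fc gc
  with Fin.any? (λ c′ → f c′ Bool.≟ false ×-dec g c′ Bool.≟ true)
... | yes deficit = deficit
... | no none = contradiction same′ (<⇒≢ fewer)
  where
  same′ : sum (b2n ∘ g) ≡ sum (b2n ∘ f)
  same′ = trans (sym (sumFin≡sum n _)) (trans (sym same) (sumFin≡sum n _))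
  g≤f : ∀ y → b2n (g y) ℕ.≤ b2n (f y)
  g≤f y with f y in fy | g y in gy
  ... | true  | gy′   = b2n≤1 gy′
  ... | false | false = z≤n
  ... | false | true  = contradiction (y , fy , gy) none
  fewer : sum (b2n ∘ g) ℕ.< sum (b2n ∘ f)
  fewer = sum-mono-< g≤f c (subst₂ (λ a b → b2n a ℕ.< b2n b) (sym gc) (sym fc) (s≤s z≤n))

module NegativeFreeUniqueness
  {A B : Matrix p q}
  (rows : ∀ i → rowSum A i ≡ rowSum B i) (cols : ∀ j → colSum A j ≡ colSum B j)
  (J : JustifiedColumns B) (free : NegativeFree A) where

  open JustifiedColumns J

  Toward : Fin q → Fin p → Fin p → Set
  Toward c r r′ = (Top c × r < r′) ⊎ (¬ Top c × r′ < r)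

  infix 4 _⇝_
  _⇝_ : Fin p → Fin p → Set
  r ⇝ r′ = ∃ λ c → A r c ≡ false × A r′ c ≡ true × Toward c r r′

  ⇝-trans : Transitive _⇝_
  ⇝-trans {r} {s} {t} (k , Ark , Ask , inj₁ (top-k , r<s)) (k′ , Ask′ , Atk′ , inj₁ (top-k′ , s<t))
    with A r k′ in Ark′
  ... | false = k′ , Ark′ , Atk′ , inj₁ (top-k′ , Fin.<-trans r<s s<t)
  ... | true with A t k in Atk
  ... | true  = k , Ark , Atk , inj₁ (top-k , Fin.<-trans r<s s<t)
  ... | false with Fin.<-cmp k k′
  ... | tri< k<k′ _ _ = ⊥-elim (free r s k k′ (r<s , k<k′ , Ark , Ark′ , Ask , Ask′))
  ... | tri≈ _ refl _ = ⊥-elim (Bool.not-¬ Ask Ask′)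
  ... | tri> _ _ k′<k = ⊥-elim (free s t k′ k (s<t , k′<k , Ask′ , Ask , Atk′ , Atk))
  ⇝-trans {r} {s} {t} (l , Arl , Asl , inj₂ (bot-l , s<r)) (l′ , Asl′ , Atl′ , inj₂ (bot-l′ , t<s))
    with A r l′ in Arl′
  ... | false = l′ , Arl′ , Atl′ , inj₂ (bot-l′ , Fin.<-trans t<s s<r)
  ... | true with A t l in Atl
  ... | true  = l , Arl , Atl , inj₂ (bot-l , Fin.<-trans t<s s<r)
  ... | false with Fin.<-cmp l′ l
  ... | tri< l′<l _ _ = ⊥-elim (free s r l′ l (s<r , l′<l , Asl′ , Asl , Arl′ , Arl))
  ... | tri≈ _ refl _ = ⊥-elim (Bool.not-¬ Asl Asl′)
  ... | tri> _ _ l<l′ = ⊥-elim (free t s l l′ (t<s , l<l′ , Atl , Atl′ , Asl , Asl′))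
  ⇝-trans {r} {s} {t} (k , Ark , Ask , inj₁ (top-k , r<s)) (l , Asl , Atl , inj₂ (bot-l , t<s))
    with top-before-bottom top-k bot-l | A r l in Arl
  ... | k<l | true = ⊥-elim (free r s k l (r<s , k<l , Ark , Arl , Ask , Asl))
  ... | k<l | false with A t k in Atk
  ... | false = ⊥-elim (free t s k l (t<s , k<l , Atk , Atl , Ask , Asl))
  ... | true with Fin.<-cmp r t
  ... | tri< r<t _ _ = k , Ark , Atk , inj₁ (top-k , r<t)
  ... | tri≈ _ refl _ = ⊥-elim (Bool.not-¬ Atl Arl)
  ... | tri> _ _ t<r = l , Arl , Atl , inj₂ (bot-l , t<r)
  ⇝-trans {r} {s} {t} (l , Arl , Asl , inj₂ (bot-l , s<r)) (k , Ask , Atk , inj₁ (top-k , s<t))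
    with top-before-bottom top-k bot-l | A r k in Ark
  ... | k<l | true = ⊥-elim (free s r k l (s<r , k<l , Ask , Asl , Ark , Arl))
  ... | k<l | false with A t l in Atl
  ... | false = ⊥-elim (free s t k l (s<t , k<l , Ask , Asl , Atk , Atl))
  ... | true with Fin.<-cmp r t
  ... | tri< r<t _ _ = k , Ark , Atk , inj₁ (top-k , r<t)
  ... | tri≈ _ refl _ = ⊥-elim (Bool.not-¬ Atk Ark)
  ... | tri> _ _ t<r = l , Arl , Atl , inj₂ (bot-l , t<r)

  ⇝-isStrictPartialOrder : IsStrictPartialOrder _≡_ _⇝_
  ⇝-isStrictPartialOrder = record
    { isEquivalence = isEquivalence
    ; irrefl        = λ { refl (_ , Arc , Arc′ , _) → Bool.not-¬ Arc′ Arc }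
    ; trans         = ⇝-trans
    ; <-resp-≈      = (λ { refl r⇝s → r⇝s }) , (λ { refl r⇝s → r⇝s })
    }

  Deficient : Fin p → Set
  Deficient r = ∃ λ c → A r c ≡ false × B r c ≡ true

  deficient-step : ∀ {r} → Deficient r → ∃ λ r′ → Deficient r′ × r ⇝ r′
  deficient-step {r} (c , Arc , Brc) with surplus⇒deficit (sym (cols c)) r Brc Arc
  ... | r′ , Br′c , Ar′c = r′ , surplus⇒deficit (rows r′) c Ar′c Br′c , c , Arc , Ar′c , toward
    where
    toward : Toward c r r′
    toward with top? c
    ... | yes top    = inj₁ (top , ≰⇒> λ r′≤r →
                                     Bool.not-¬ (top-justified top r′ r r′≤r Brc) Br′c)
    ... | no  bottom = inj₂ (bottom , ≰⇒> λ r≤r′ →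
                                        Bool.not-¬ (bottom-justified bottom r r′ r≤r′ Brc) Br′c)

  never-deficient : ∀ {r} → Acc (flip _⇝_) r → ¬ Deficient r
  never-deficient (acc further) d with deficient-step d
  ... | _ , d′ , r⇝r′ = never-deficient (further r⇝r′) d′

  A≐B : A ≐ B
  A≐B r c with A r c in Arc | B r c in Brc
  ... | false | false = refl
  ... | true  | true  = refl
  ... | false | true  = ⊥-elim (never-deficient (spo-noetherian ⇝-isStrictPartialOrder r) (c , Arc , Brc))
  ... | true  | false = ⊥-elim (never-deficient (spo-noetherian ⇝-isStrictPartialOrder r)
                                                (surplus⇒deficit (rows r) c Arc Brc))

NegativeFree-transpose : NegativeFree A → NegativeFree (transpose A)
NegativeFree-transpose free k l i j (k<l , i<j , Aik , Ajk , Ail , Ajl) =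
  free i j k l (i<j , k<l , Aik , Ail , Ajk , Ajl)

-- Split zebras and split anti-zebras have justified columns, up to transposition

opposite-anti : {i j : Fin n} → i ≤ j → opposite j ≤ opposite i
opposite-anti {n} {i} {j} i≤j rewrite Fin.opposite-prop i | Fin.opposite-prop j = ∸-monoʳ-≤ n (s≤s i≤j)

module _ {v v′ : Fin n → Bool} where

  TopJustified-resp : (∀ i → v i ≡ v′ i) → TopJustified v → TopJustified v′
  TopJustified-resp v≐v′ tj i i′ i≤i′ v′i′ =
    trans (sym (v≐v′ i)) (tj i i′ i≤i′ (trans (v≐v′ i′) v′i′))

  BottomJustified-resp : (∀ i → v i ≡ v′ i) → BottomJustified v → BottomJustified v′
  BottomJustified-resp v≐v′ bj i i′ i≤i′ v′i =
    trans (sym (v≐v′ i′)) (bj i i′ i≤i′ (trans (v≐v′ i) v′i))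

module _ {v : Fin n → Bool} where

  reverse-top : TopJustified v → BottomJustified (v ∘ opposite)
  reverse-top tj i i′ i≤i′ = tj (opposite i′) (opposite i) (opposite-anti i≤i′)

  reverse-bottom : BottomJustified v → TopJustified (v ∘ opposite)
  reverse-bottom bj i i′ i≤i′ = bj (opposite i′) (opposite i) (opposite-anti i≤i′)

  complement-top : TopJustified v → BottomJustified (not ∘ v)
  complement-top tj i i′ i≤i′ ¬vi with v i′ in vi′
  ... | false = refl
  ... | true  = ⊥-elim (Bool.not-¬ (tj i i′ i≤i′ vi′) (Bool.not-injective ¬vi))

  complement-bottom : BottomJustified v → TopJustified (not ∘ v)
  complement-bottom bj i i′ i≤i′ ¬vi′ with v i in vi
  ... | false = refl
  ... | true  = ⊥-elim (Bool.not-¬ (bj i i′ i≤i′ vi) (Bool.not-injective ¬vi′))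

justified-resp : {M M′ : Matrix p q} → M ≐ M′ → JustifiedColumns M → JustifiedColumns M′
justified-resp M≐M′ J = record
  { Top               = Top
  ; top?              = top?
  ; top-justified     = λ top → TopJustified-resp (λ i → M≐M′ i _) (top-justified top)
  ; bottom-justified  = λ bottom → BottomJustified-resp (λ i → M≐M′ i _) (bottom-justified bottom)
  ; top-before-bottom = top-before-bottom
  }
  where open JustifiedColumns J

complement-reverseRows : {M : Matrix p q} → JustifiedColumns M →
                         JustifiedColumns (λ i j → not (M (opposite i) j))
complement-reverseRows J = record
  { Top               = Top
  ; top?              = top?
  ; top-justified     = λ top → complement-bottom (reverse-top (top-justified top))
  ; bottom-justified  = λ bottom → complement-top (reverse-bottom (bottom-justified bottom))
  ; top-before-bottom = top-before-bottom
  }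
  where open JustifiedColumns J

complement-reverseCols : {M : Matrix p q} → JustifiedColumns M →
                         JustifiedColumns (λ i j → not (M i (opposite j)))
complement-reverseCols J = record
  { Top               = λ j → ¬ Top (opposite j)
  ; top?              = λ j → ¬? (top? (opposite j))
  ; top-justified     = λ bottom → complement-bottom (bottom-justified bottom)
  ; bottom-justified  = λ ¬bottom → complement-top (top-justified (decidable-stable (top? _) ¬bottom))
  ; top-before-bottom = λ bottom-k ¬bottom-l → ≰⇒> λ l≤k →
      <⇒≱ (top-before-bottom (decidable-stable (top? _) ¬bottom-l) bottom-k) (opposite-anti l≤k)
  }
  where open JustifiedColumns J

vertical⇒justified : {B : Matrix p q} → SplitVertically B → JustifiedColumns B
vertical⇒justified {B = B} (N , N′ , (nested , antiNested , B≡N+N′) , split) = record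
  { Top               = λ c → ∃ λ i → N i c ≡ true
  ; top?              = λ c → Fin.any? λ i → N i c Bool.≟ true
  ; top-justified     = λ top → TopJustified-resp (N≐B top) (proj₂ nested _)
  ; bottom-justified  = λ bottom → BottomJustified-resp (N′≐B bottom) (proj₂ antiNested _)
  ; top-before-bottom = λ (i , Nik) bottom → ≰⇒> λ l≤k → bottom (i , proj₁ nested i _ _ l≤k Nik)
  }
  where
  N≐B : ∀ {c} → (∃ λ i → N i c ≡ true) → ∀ i → N i c ≡ B i c
  N≐B {c} (i₀ , Ni₀c) i with split c
  ... | inj₁ N-empty  = ⊥-elim (Bool.not-¬ Ni₀c (N-empty i₀))
  ... | inj₂ N′-empty = b2n-injective (sym (begin
    b2n (B i c)                  ≡⟨ B≡N+N′ i c ⟩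
    b2n (N i c) + b2n (N′ i c)   ≡⟨ cong (λ b → b2n (N i c) + b2n b) (N′-empty i) ⟩
    b2n (N i c) + 0              ≡⟨ +-identityʳ _ ⟩
    b2n (N i c)                  ∎))
    where open ≡-Reasoning
  N′≐B : ∀ {c} → ¬ (∃ λ i → N i c ≡ true) → ∀ i → N′ i c ≡ B i c
  N′≐B {c} bottom i =
    b2n-injective (sym (trans (B≡N+N′ i c) (cong (λ b → b2n b + b2n (N′ i c)) N-empty)))
    where
    N-empty : N i c ≡ false
    N-empty = Bool.¬-not (bottom ∘ (i ,_))

horizontal⇒transpose-vertical : {B : Matrix p q} → SplitHorizontally B → SplitVertically (transpose B)
horizontal⇒transpose-vertical (N , N′ , (nested , antiNested , B≡N+N′) , split) =
  transpose N , transpose N′ , (swap nested , swap antiNested , λ j i → B≡N+N′ i j) , split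

shape⇒justified : {B : Matrix p q} → SplitZebra B ⊎ SplitAntiZebra B →
                  JustifiedColumns B ⊎ JustifiedColumns (transpose B)
shape⇒justified (inj₁ (inj₁ vertical))   = inj₁ (vertical⇒justified vertical)
shape⇒justified (inj₁ (inj₂ horizontal)) =
  inj₂ (vertical⇒justified (horizontal⇒transpose-vertical horizontal))
shape⇒justified (inj₂ (Z , inj₁ vertical , B≡Z̃)) =
  inj₁ (justified-resp (λ i j → sym (B≡Z̃ i j)) (complement-reverseRows (vertical⇒justified vertical)))
shape⇒justified (inj₂ (Z , inj₂ horizontal , B≡Z̃)) =
  inj₂ (justified-resp (λ j i → sym (B≡Z̃ i j))
         (complement-reverseCols (vertical⇒justified (horizontal⇒transpose-vertical horizontal))))

corollary2 : (p q : ℕ) (R : Fin p → ℕ) (C : Fin q → ℕ) (B : Matrix p q) →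
    InM R C B → SplitZebra B ⊎ SplitAntiZebra B →
    (A : Matrix p q) → InM R C A → Reachable A B
corollary2 p q R C B (rowsB , colsB) shape = reachable negativeFree≐B
  where
  negativeFree≐B : ∀ A → InM R C A → NegativeFree A → A ≐ B
  negativeFree≐B A (rowsA , colsA) free =
    [ (λ J → NegativeFreeUniqueness.A≐B rows cols J free)
    , (λ J i j → NegativeFreeUniqueness.A≐B cols rows J (NegativeFree-transpose free) j i)
    ] (shape⇒justified shape)
    where
    rows : ∀ i → rowSum A i ≡ rowSum B i
    rows i = trans (rowsA i) (sym (rowsB i))
    cols : ∀ j → colSum A j ≡ colSum B j
    cols j = trans (colsA j) (sym (colsB j))
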